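{- Let $n > 11$ be an integer, $r = n-4$, and let $G$ be an $r$-regular graph with $V(G)=\{v_1,\dots,v_n\}$ and $E(G)=\{e_1,\dots,e_m\}$. Let $H$ be the bipartite graph constructed from $G$ as described in the context, and let $k$ be a positive integer. If $G$ contains a clique of size $k$, then there exist $k+x$ pairwise non-adjacent vertices in $H$ that together cover at least $kr + x(r-1)$ edges of $H$, where $x = m - \left(kr - \binom{k}{2}\right)$.
   Context: Construction of $H$: $H$ is bipartite with parts $A$ and $B$, where $A=\{a_1,\dots,a_m\}$ (one vertex per edge of $G$), $B=\beta\cup\Pi$ with $\beta=\{b_1,\dots,b_n\}$ (one vertex per vertex of $G$) and $\Pi=\{p_{i,j} : i\in[m],\ j\in[r-3]\}$. The edge set is $E(H)=\{a_ip_{i,j} : i\in[m], j\in[r-3]\}\cup\{a_ib_j : \text{edge } e_i \text{ is incident to vertex } v_j \text{ in } G\}$. Thus $\deg(a_i)=r-1$, $\deg(b_j)=r$, and each $p_{i,j}$ has degree $1$. An edge is covered by a vertex set if at least one endpoint lies in the set. $[N]=\{1,\dots,N\}$. -}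

module Defs where

open import Data.Nat using (ℕ; _∸_; _*_; _+_)
open import Data.Nat.Combinatorics using (_C_)
open import Data.Fin using (Fin; _<_) renaming (_≟_ to _≟F_)
open import Data.Fin.Properties using (_<?_)
open import Data.Product using (_×_; _,_; proj₁; proj₂; Σ)
open import Data.Sum using (_⊎_; inj₁; inj₂)
open import Relation.Nullary.Decidable using (_⊎-dec_)
open import Data.Empty using (⊥)
open import Data.List using (List; length; filter; allFin; map; _++_; cartesianProduct)
open import Data.List.Relation.Unary.AllPairs using (AllPairs)
open import Relation.Nullary using (¬_; Dec; yes; no)
open import Relation.Binary.PropositionalEquality using (_≡_)
open import Relation.Binary.Definitions using (DecidableEquality)
import Data.Sum.Properties as SumP
import Data.Product.Properties as ProdP
import Data.List.Membership.DecPropositional as DecMem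

-- A simple graph G on vertex set V(G) = Fin n with labelled edge set
-- E(G) = {e_1,…,e_m}: each edge e i is stored as the ordered pair (u , w)
-- of its endpoints with u < w (so no loops), and distinct labels give
-- distinct edges (injectivity), so there are no multi-edges.
EdgeList : ℕ → ℕ → Set
EdgeList n m = Fin m → Fin n × Fin n

IsSimpleEdgeList : {n m : ℕ} → EdgeList n m → Set
IsSimpleEdgeList {n} {m} e =
  ((i : Fin m) → proj₁ (e i) < proj₂ (e i)) ×
  ((i j : Fin m) → e i ≡ e j → i ≡ j)

Incident : {n : ℕ} → Fin n × Fin n → Fin n → Set
Incident (u , w) v = (v ≡ u) ⊎ (v ≡ w)

incident? : {n : ℕ} → (p : Fin n × Fin n) → (v : Fin n) → Dec (Incident p v)
incident? (u , w) v = (v ≟F u) ⊎-dec (v ≟F w)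

degree : {n m : ℕ} → EdgeList n m → Fin n → ℕ
degree {n} {m} e v = length (filter (λ i → incident? (e i) v) (allFin m))

IsRegular : {n m : ℕ} → ℕ → EdgeList n m → Set
IsRegular {n} r e = (v : Fin n) → degree e v ≡ r

Adj : {n m : ℕ} → EdgeList n m → Fin n → Fin n → Set
Adj {n} {m} e u v = Σ (Fin m) (λ i → (e i ≡ (u , v)) ⊎ (e i ≡ (v , u)))

-- G contains a clique of size k: k vertices, pairwise adjacent
-- (hence pairwise distinct, as G has no loops)
HasClique : {n m : ℕ} → EdgeList n m → ℕ → Set
HasClique {n} e k =
  Σ (List (Fin n)) (λ K → (length K ≡ k) × AllPairs (Adj e) K)

-- The bipartite graph H built from G, with parameter r.
-- A = {a_1..a_m} = Fin m ;  B = β ∪ Π,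
-- β = {b_1..b_n} = Fin n, Π = {p_{i,j}} = Fin m × Fin (r ∸ 3).

HB : ℕ → ℕ → ℕ → Set
HB n m r = Fin n ⊎ (Fin m × Fin (r ∸ 3))

HVertex : ℕ → ℕ → ℕ → Set
HVertex n m r = Fin m ⊎ HB n m r

-- edges of H: a_i p_{i,j}, and a_i b_j when e_i is incident to v_j
HEdge : {n m : ℕ} (r : ℕ) → EdgeList n m → Fin m → HB n m r → Set
HEdge r e i (inj₁ v) = Incident (e i) v
HEdge r e i (inj₂ (i' , j)) = i ≡ i'

hEdge? : {n m : ℕ} (r : ℕ) (e : EdgeList n m) → (i : Fin m) → (y : HB n m r) → Dec (HEdge r e i y)
hEdge? r e i (inj₁ v) = incident? (e i) v
hEdge? r e i (inj₂ (i' , j)) = i ≟F i'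

HAdj : {n m : ℕ} (r : ℕ) → EdgeList n m → HVertex n m r → HVertex n m r → Set
HAdj r e (inj₁ i) (inj₂ y) = HEdge r e i y
HAdj r e (inj₂ y) (inj₁ i) = HEdge r e i y
HAdj r e (inj₁ _) (inj₁ _) = ⊥
HAdj r e (inj₂ _) (inj₂ _) = ⊥

allB : (n m r : ℕ) → List (HB n m r)
allB n m r = map inj₁ (allFin n) ++ map inj₂ (cartesianProduct (allFin m) (allFin (r ∸ 3)))

_≟V_ : {n m r : ℕ} → DecidableEquality (HVertex n m r)
_≟V_ = SumP.≡-dec _≟F_ (SumP.≡-dec _≟F_ (ProdP.≡-dec _≟F_ _≟F_))

-- the list of all edges of H, each as a pair (i , y) standing for a_i y
HEdges : {n m : ℕ} (r : ℕ) → EdgeList n m → List (Fin m × HB n m r)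
HEdges {n} {m} r e =
  filter (λ ab → hEdge? r e (proj₁ ab) (proj₂ ab))
         (cartesianProduct (allFin m) (allB n m r))

coveredEdges : {n m : ℕ} (r : ℕ) → EdgeList n m → List (HVertex n m r) → ℕ
coveredEdges {n} {m} r e S =
  length (filter (λ ab → (inj₁ (proj₁ ab) ∈? S) ⊎-dec (inj₂ (proj₂ ab) ∈? S)) (HEdges r e))
  where open DecMem (_≟V_ {n} {m} {r}) using (_∈?_)

module Submission where

open import Defs
open import Data.Nat using (ℕ; _∸_; _*_; _+_; _≥_; _>_)
open import Data.Nat.Combinatorics using (_C_)
open import Data.Product using (_×_; Σ)
open import Data.List using (List; length)
open import Data.List.Relation.Unary.AllPairs using (AllPairs)
open import Relation.Nullary using (¬_)
open import Relation.Binary.PropositionalEquality using (_≡_)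

open import Data.Nat using (suc; _≤_; z≤n; s≤s)
open import Data.Nat.Properties
open import Data.Nat.Combinatorics using (nCk+nC[k+1]≡[n+1]C[k+1]; nC1≡n)
open import Data.Nat.ListAction using (sum)
open import Data.Nat.Solver using (module +-*-Solver)
open import Algebra.Properties.CommutativeSemigroup +-commutativeSemigroup using (interchange)
open import Data.Empty using (⊥)
open import Data.Product using (_,_; proj₁; proj₂)
open import Data.Sum using (_⊎_; inj₁; inj₂)
import Data.Sum.Properties as Sum
import Data.Product.Properties as Product
open import Data.Fin using (Fin; _<_) renaming (_≟_ to _≟F_)
import Data.Fin.Properties as Fin
open import Data.List using ([]; _∷_; filter; map; _++_; take; allFin; cartesianProduct)
open import Data.List.Properties
  using (filter-++; filter-some; filter-none; map-cong; length-++; length-map; length-take; length-tabulate)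
open import Data.List.Relation.Unary.All as All using (All; []; _∷_)
import Data.List.Relation.Unary.All.Properties as All
open import Data.List.Relation.Unary.Any as Any using (Any; here; there; any?)
open import Data.List.Relation.Unary.AllPairs as AllPairs using ([]; _∷_)
import Data.List.Relation.Unary.AllPairs.Properties as AllPairs
open import Data.List.Relation.Unary.Unique.Propositional using (Unique)
import Data.List.Relation.Unary.Unique.Propositional.Properties as Unique
open import Data.List.Membership.Propositional using (_∈_)
open import Data.List.Membership.Propositional.Properties
  using (∈-allFin; ∈-++⁺ˡ; ∈-++⁺ʳ; ∈-map⁺; ∈-cartesianProduct⁺)
import Data.List.Membership.DecPropositional as DecMembership
open import Relation.Nullary using (Dec; yes; no; ¬?; contradiction)
open import Relation.Nullary.Decidable using (_×-dec_; _⊎-dec_)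
open import Relation.Unary using (Decidable; _⊆_)
open import Relation.Binary.Definitions using (DecidableEquality)
open import Relation.Binary.PropositionalEquality
  using (_≢_; refl; sym; trans; cong; cong₂; subst; module ≡-Reasoning)

-- Write r = n − 4 and let K be a k-clique of G.  As G is r-regular, the k vertices of K lie on
-- kr edge-incidences, and each of the C(k,2) edges inside K is met twice, so at most
-- kr − C(k,2) edges of G touch K and at least x = m − (kr − C(k,2)) edges avoid it.  Choose x
-- such edges I and take S = {b_v : v ∈ K} ∪ {a_i : i ∈ I}.  S has no repeated vertex and is
-- independent in H: the b_v and the a_i lie on different sides, and a_i b_v is an edge only if
-- v is an endpoint of eᵢ, which the choice of I excludes.  S covers the r edges at each b_v and
-- the r − 1 edges at each a_i, and no edge is counted twice, giving kr + x(r − 1) covered edges.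

count : {A : Set} {P : A → Set} → Decidable P → List A → ℕ
count P? xs = length (filter P? xs)

indicator : {P : Set} → Dec P → ℕ
indicator (yes _) = 1
indicator (no _)  = 0

module _ {A : Set} {P : A → Set} (P? : Decidable P) where

  count-cons : (x : A) (xs : List A) → count P? (x ∷ xs) ≡ indicator (P? x) + count P? xs
  count-cons x xs with P? x
  ... | yes _ = refl
  ... | no _  = refl

  count-as-sum : (xs : List A) → count P? xs ≡ sum (map (λ x → indicator (P? x)) xs)
  count-as-sum []       = refl
  count-as-sum (x ∷ xs) with P? x
  ... | yes _ = cong suc (count-as-sum xs)
  ... | no _  = count-as-sum xs

  count-complement : (xs : List A) → count P? xs + count (λ x → ¬? (P? x)) xs ≡ length xs
  count-complement []       = refl
  count-complement (x ∷ xs) with P? x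
  ... | yes _ = cong suc (count-complement xs)
  ... | no _  = trans (+-suc _ _) (cong suc (count-complement xs))

  count-++ : (xs ys : List A) → count P? (xs ++ ys) ≡ count P? xs + count P? ys
  count-++ xs ys = trans (cong length (filter-++ P? xs ys)) (length-++ (filter P? xs))

  sum-≥ : (c : ℕ) (f : A → ℕ) → (∀ {x} → P x → c ≤ f x) → (xs : List A) →
          c * count P? xs ≤ sum (map f xs)
  sum-≥ c f bound []       = ≤-reflexive (*-zeroʳ c)
  sum-≥ c f bound (x ∷ xs) with P? x
  ... | yes p = ≤-trans (≤-reflexive (*-suc c _)) (+-mono-≤ (bound p) (sum-≥ c f bound xs))
  ... | no _  = ≤-trans (sum-≥ c f bound xs) (m≤n+m _ _)

count-map : {A B : Set} {P : A → Set} (P? : Decidable P) (f : B → A) (xs : List B) →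
            count P? (map f xs) ≡ count (λ x → P? (f x)) xs
count-map P? f []       = refl
count-map P? f (x ∷ xs) with P? (f x)
... | yes _ = cong suc (count-map P? f xs)
... | no _  = count-map P? f xs

module _ {A : Set} {P Q : A → Set} (P? : Decidable P) (Q? : Decidable Q) where

  count-mono : P ⊆ Q → (xs : List A) → count P? xs ≤ count Q? xs
  count-mono P⊆Q []       = z≤n
  count-mono P⊆Q (x ∷ xs) with P? x | Q? x
  ... | yes _ | yes _  = s≤s (count-mono P⊆Q xs)
  ... | yes p | no ¬q  = contradiction (P⊆Q p) ¬q
  ... | no _  | yes _  = m≤n⇒m≤1+n (count-mono P⊆Q xs)
  ... | no _  | no _   = count-mono P⊆Q xs

  count-split : (xs : List A) →
    count P? xs ≡ count (λ x → P? x ×-dec Q? x) xs + count (λ x → P? x ×-dec ¬? (Q? x)) xs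
  count-split []       = refl
  count-split (x ∷ xs) with P? x | Q? x
  ... | yes _ | yes _ = cong suc (count-split xs)
  ... | yes _ | no _  = trans (cong suc (count-split xs)) (sym (+-suc _ _))
  ... | no _  | _     = count-split xs

  count-filter : (xs : List A) → count P? (filter Q? xs) ≡ count (λ x → Q? x ×-dec P? x) xs
  count-filter []       = refl
  count-filter (x ∷ xs) with Q? x
  ... | no _  = count-filter xs
  ... | yes _ with P? x
  ...   | yes _ = cong suc (count-filter xs)
  ...   | no _  = count-filter xs

distinct-≤-count : {A : Set} {P : A → Set} → DecidableEquality A → (P? : Decidable P) {xs : List A}
  (L : List A) → Unique L → All (λ y → y ∈ xs × P y) L → length L ≤ count P? xs
distinct-≤-count _≟_ P? []      _            _ = z≤n
distinct-≤-count {P = P} _≟_ P? {xs} (y ∷ L) (y∉L ∷ uniqueL) ((y∈xs , Py) ∷ inL) = begin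
  1 + length L
    ≤⟨ +-mono-≤ (filter-some (λ x → P? x ×-dec (x ≟ y)) (Any.map (λ { refl → Py , refl }) y∈xs))
                (distinct-≤-count _≟_ (λ x → P? x ×-dec ¬? (x ≟ y)) L uniqueL inL-≢y) ⟩
  count (λ x → P? x ×-dec (x ≟ y)) xs + count (λ x → P? x ×-dec ¬? (x ≟ y)) xs
    ≡⟨ count-split P? (_≟ y) xs ⟨
  count P? xs ∎
  where
  open ≤-Reasoning
  inL-≢y : All (λ z → z ∈ xs × (P z × ¬ z ≡ y)) L
  inL-≢y = All.zipWith (λ { ((z∈xs , Pz) , y≢z) → z∈xs , Pz , λ z≡y → y≢z (sym z≡y) }) (inL , y∉L)

distinct-≤-members : {k : ℕ} (L : List (Fin k)) → Unique L →
  length L ≤ count (λ i → DecMembership._∈?_ _≟F_ i L) (allFin k)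
distinct-≤-members L uniqueL =
  distinct-≤-count _≟F_ (λ i → DecMembership._∈?_ _≟F_ i L) L uniqueL
    (All.tabulate (λ {i} i∈L → ∈-allFin i , i∈L))

count-disjoint-≤ : {A : Set} {P Q R : A → Set} (P? : Decidable P) (Q? : Decidable Q) (R? : Decidable R) →
  P ⊆ R → Q ⊆ R → (∀ {x} → P x → ¬ Q x) → (xs : List A) →
  count P? xs + count Q? xs ≤ count R? xs
count-disjoint-≤ P? Q? R? P⊆R Q⊆R disjoint xs = begin
  count P? xs + count Q? xs
    ≤⟨ +-mono-≤ (count-mono P? (λ x → R? x ×-dec P? x) (λ p → P⊆R p , p) xs)
                (count-mono Q? (λ x → R? x ×-dec ¬? (P? x)) (λ q → Q⊆R q , λ p → disjoint p q) xs) ⟩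
  count (λ x → R? x ×-dec P? x) xs + count (λ x → R? x ×-dec ¬? (P? x)) xs
    ≡⟨ count-split R? P? xs ⟨
  count R? xs ∎
  where open ≤-Reasoning

count-cartesianProduct : {A B : Set} {P : A × B → Set} (P? : Decidable P) (xs : List A) (ys : List B) →
  count P? (cartesianProduct xs ys) ≡ sum (map (λ x → count (λ y → P? (x , y)) ys) xs)
count-cartesianProduct P? []       ys = refl
count-cartesianProduct P? (x ∷ xs) ys = begin
  count P? (map (x ,_) ys ++ cartesianProduct xs ys)
    ≡⟨ count-++ P? (map (x ,_) ys) (cartesianProduct xs ys) ⟩
  count P? (map (x ,_) ys) + count P? (cartesianProduct xs ys)
    ≡⟨ cong₂ _+_ (count-map P? (x ,_) ys) (count-cartesianProduct P? xs ys) ⟩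
  count (λ y → P? (x , y)) ys + sum (map (λ x → count (λ y → P? (x , y)) ys) xs) ∎
  where open ≡-Reasoning

sum-mono : {A : Set} (f g : A → ℕ) → (∀ x → f x ≤ g x) → (xs : List A) →
  sum (map f xs) ≤ sum (map g xs)
sum-mono f g f≤g []       = z≤n
sum-mono f g f≤g (x ∷ xs) = +-mono-≤ (f≤g x) (sum-mono f g f≤g xs)

sum-map-+ : {A : Set} (f g : A → ℕ) (xs : List A) →
  sum (map (λ x → f x + g x) xs) ≡ sum (map f xs) + sum (map g xs)
sum-map-+ f g []       = refl
sum-map-+ f g (x ∷ xs) = trans (cong (f x + g x +_) (sum-map-+ f g xs)) (interchange (f x) (g x) _ _)

sum-map-zero : {A : Set} (xs : List A) → sum (map (λ _ → 0) xs) ≡ 0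
sum-map-zero []       = refl
sum-map-zero (x ∷ xs) = sum-map-zero xs

sum-swap : {A B : Set} {R : A → B → Set} (R? : ∀ x y → Dec (R x y)) (xs : List A) (ys : List B) →
  sum (map (λ x → count (R? x) ys) xs) ≡ sum (map (λ y → count (λ x → R? x y) xs) ys)
sum-swap R? []       ys = sym (sum-map-zero ys)
sum-swap R? (x ∷ xs) ys = begin
  count (R? x) ys + sum (map (λ x → count (R? x) ys) xs)
    ≡⟨ cong₂ _+_ (count-as-sum (R? x) ys) (sum-swap R? xs ys) ⟩
  sum (map (λ y → indicator (R? x y)) ys) + sum (map (λ y → count (λ x → R? x y) xs) ys)
    ≡⟨ sum-map-+ (λ y → indicator (R? x y)) (λ y → count (λ x → R? x y) xs) ys ⟨
  sum (map (λ y → indicator (R? x y) + count (λ x → R? x y) xs) ys)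
    ≡⟨ cong sum (map-cong (λ y → count-cons (λ x → R? x y) x xs) ys) ⟨
  sum (map (λ y → count (λ x → R? x y) (x ∷ xs)) ys) ∎
  where open ≡-Reasoning

-- Pascal's rule for pairs: a new element forms a pair with each of the l old ones
suc-C-2 : (l : ℕ) → suc l C 2 ≡ l + l C 2
suc-C-2 l = trans (sym (nCk+nC[k+1]≡[n+1]C[k+1] l 1)) (cong (_+ l C 2) (nC1≡n l))

module _ {n m : ℕ} (e : EdgeList n m) where

  Touches : List (Fin n) → Fin m → Set
  Touches K i = Any (Incident (e i)) K

  touches? : (K : List (Fin n)) (i : Fin m) → Dec (Touches K i)
  touches? K i = any? (incident? (e i)) K

  avoids? : (K : List (Fin n)) (i : Fin m) → Dec (¬ Touches K i)
  avoids? K i = ¬? (touches? K i)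

  touching-cons : (v : Fin n) (K : List (Fin n)) →
    count (touches? (v ∷ K)) (allFin m)
      ≤ count (touches? K) (allFin m) + count (λ i → incident? (e i) v ×-dec avoids? K i) (allFin m)
  touching-cons v K = begin
    count (touches? (v ∷ K)) (allFin m)
      ≡⟨ count-split (touches? (v ∷ K)) (touches? K) (allFin m) ⟩
    count (λ i → touches? (v ∷ K) i ×-dec touches? K i) (allFin m)
      + count (λ i → touches? (v ∷ K) i ×-dec avoids? K i) (allFin m)
      ≤⟨ +-mono-≤ (count-mono _ (touches? K) proj₂ (allFin m)) (count-mono _ _ at-v (allFin m)) ⟩
    count (touches? K) (allFin m) + count (λ i → incident? (e i) v ×-dec avoids? K i) (allFin m) ∎
    where
    open ≤-Reasoning
    at-v : ∀ {i} → Touches (v ∷ K) i × ¬ Touches K i → Incident (e i) v × ¬ Touches K i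
    at-v (here v∈eᵢ , ¬t) = v∈eᵢ , ¬t
    at-v (there t   , ¬t) = contradiction t ¬t

  module _ (simple : IsSimpleEdgeList e) where

    no-loop : ∀ i {u} → e i ≢ (u , u)
    no-loop i eq = Fin.<-irrefl refl (subst (λ p → proj₁ p < proj₂ p) eq (proj₁ simple i))

    adjacent⇒distinct : ∀ {u v} → Adj e u v → u ≢ v
    adjacent⇒distinct (i , inj₁ eq) refl = no-loop i eq
    adjacent⇒distinct (i , inj₂ eq) refl = no-loop i eq

    joining-edge-incident : ∀ {u v} (u~v : Adj e u v) →
      Incident (e (proj₁ u~v)) u × Incident (e (proj₁ u~v)) v
    joining-edge-incident (i , inj₁ eq) =
      subst (λ p → Incident p _ × Incident p _) (sym eq) (inj₁ refl , inj₂ refl)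
    joining-edge-incident (i , inj₂ eq) =
      subst (λ p → Incident p _ × Incident p _) (sym eq) (inj₂ refl , inj₁ refl)

    joining-edge-endpoints : ∀ {u v w} (u~v : Adj e u v) → Incident (e (proj₁ u~v)) w → w ≡ u ⊎ w ≡ v
    joining-edge-endpoints (i , inj₁ eq) w∈eᵢ = subst (λ p → Incident p _) eq w∈eᵢ
    joining-edge-endpoints (i , inj₂ eq) w∈eᵢ with subst (λ p → Incident p _) eq w∈eᵢ
    ... | inj₁ w≡v = inj₂ w≡v
    ... | inj₂ w≡u = inj₁ w≡u

    -- a vertex v adjacent to every vertex of a clique K lies on at least |K| edges touching K;
    -- by induction on K = u ∷ K', since the edge vu touches u but avoids K'
    edges-into-clique : ∀ {v} (K : List (Fin n)) → AllPairs (Adj e) K → All (Adj e v) K →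
      length K ≤ count (λ i → incident? (e i) v ×-dec touches? K i) (allFin m)
    edges-into-clique []      _                  _            = z≤n
    edges-into-clique {v} (u ∷ K) (u~K ∷ clique) (v~u ∷ v~K) = begin
      1 + length K
        ≡⟨ +-comm 1 (length K) ⟩
      length K + 1
        ≤⟨ +-mono-≤ (≤-trans (edges-into-clique K clique v~K) old-edges)
                    (filter-some V∧¬K? (Any.map (λ { refl → vu-edge }) (∈-allFin (proj₁ v~u)))) ⟩
      count V∧K? (allFin m) + count V∧¬K? (allFin m)
        ≡⟨ count-split V? (touches? K) (allFin m) ⟨
      count V? (allFin m) ∎
      where
      open ≤-Reasoning
      V : Fin m → Set
      V i = Incident (e i) v × Touches (u ∷ K) i
      V? : (i : Fin m) → Dec (V i)
      V? i = incident? (e i) v ×-dec touches? (u ∷ K) i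
      V∧K? : (i : Fin m) → Dec (V i × Touches K i)
      V∧K? i = V? i ×-dec touches? K i
      V∧¬K? : (i : Fin m) → Dec (V i × ¬ Touches K i)
      V∧¬K? i = V? i ×-dec avoids? K i
      old-edges : count (λ i → incident? (e i) v ×-dec touches? K i) (allFin m) ≤ count V∧K? (allFin m)
      old-edges = count-mono _ V∧K? (λ (v∈eᵢ , t) → (v∈eᵢ , there t) , t) (allFin m)
      -- the edge vu touches u but no vertex of K, as both v and u are adjacent to all of K
      vu-edge : V (proj₁ v~u) × ¬ Touches K (proj₁ v~u)
      vu-edge = (proj₁ (joining-edge-incident v~u) , here (proj₂ (joining-edge-incident v~u)))
              , All.All¬⇒¬Any (All.zipWith not-endpoint (v~K , u~K))
        where
        not-endpoint : ∀ {w} → Adj e v w × Adj e u w → ¬ Incident (e (proj₁ v~u)) w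
        not-endpoint (v~w , u~w) w∈e with joining-edge-endpoints v~u w∈e
        ... | inj₁ refl = adjacent⇒distinct v~w refl
        ... | inj₂ refl = adjacent⇒distinct u~w refl

    module _ {r : ℕ} (regular : IsRegular r e) where

      -- By induction:
      -- adding v in front of K adds the c edges at v that avoid K, and the other b ≥ |K| edges
      -- at v (edges-into-clique) make c = r − b ≤ r − |K|, while C(|K|,2) grows by |K|.
      clique-touching-bound : (K : List (Fin n)) → AllPairs (Adj e) K →
        count (touches? K) (allFin m) + length K C 2 ≤ length K * r
      clique-touching-bound []      []             =
        ≤-reflexive (cong (λ c → c + 0)
          (cong length (filter-none (touches? []) (All.universal (λ _ ()) (allFin m)))))
      clique-touching-bound (v ∷ K) (v~K ∷ clique) = begin
        count (touches? (v ∷ K)) (allFin m) + suc l C 2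
          ≡⟨ cong (count (touches? (v ∷ K)) (allFin m) +_) (suc-C-2 l) ⟩
        count (touches? (v ∷ K)) (allFin m) + (l + l C 2)
          ≤⟨ +-monoˡ-≤ (l + l C 2) (touching-cons v K) ⟩
        (count (touches? K) (allFin m) + c) + (l + l C 2)
          ≡⟨ rearrange (count (touches? K) (allFin m)) c l (l C 2) ⟩
        (count (touches? K) (allFin m) + l C 2) + (c + l)
          ≤⟨ +-mono-≤ (clique-touching-bound K clique) (+-monoʳ-≤ c (edges-into-clique K clique v~K)) ⟩
        l * r + (c + b)
          ≡⟨ cong (l * r +_) (trans (+-comm c b) degree-split) ⟩
        l * r + r
          ≡⟨ +-comm (l * r) r ⟩
        suc l * r ∎
        where
        open ≤-Reasoning
        l : ℕ
        l = length K
        b c : ℕ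
        b = count (λ i → incident? (e i) v ×-dec touches? K i) (allFin m)
        c = count (λ i → incident? (e i) v ×-dec avoids? K i) (allFin m)
        degree-split : b + c ≡ r
        degree-split = trans (sym (count-split (λ i → incident? (e i) v) (touches? K) (allFin m))) (regular v)
        rearrange : ∀ a c l d → (a + c) + (l + d) ≡ (a + d) + (c + l)
        rearrange = +-*-Solver.solve 4 (λ a c l d → (a :+ c) :+ (l :+ d) := (a :+ d) :+ (c :+ l)) refl
          where open +-*-Solver

      many-edges-avoid-clique : (K : List (Fin n)) → AllPairs (Adj e) K →
        m ∸ (length K * r ∸ length K C 2) ≤ count (avoids? K) (allFin m)
      many-edges-avoid-clique K clique = begin
        m ∸ (length K * r ∸ length K C 2)
          ≤⟨ ∸-monoʳ-≤ m (m+n≤o⇒m≤o∸n t (clique-touching-bound K clique)) ⟩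
        m ∸ t
          ≡⟨ cong (_∸ t) all-edges ⟨
        t + count (avoids? K) (allFin m) ∸ t
          ≡⟨ m+n∸m≡n t _ ⟩
        count (avoids? K) (allFin m) ∎
        where
        open ≤-Reasoning
        t : ℕ
        t = count (touches? K) (allFin m)
        all-edges : t + count (avoids? K) (allFin m) ≡ m
        all-edges = trans (count-complement (touches? K) (allFin m)) (length-tabulate (λ i → i))

module _ {n m : ℕ} (e : EdgeList n m) (r : ℕ) where

  open DecMembership (_≟F_ {m}) using () renaming (_∈?_ to _∈A?_)
  open DecMembership (_≟F_ {n}) using () renaming (_∈?_ to _∈β?_)
  open DecMembership (_≟V_ {n} {m} {r}) using () renaming (_∈?_ to _∈H?_)

  allEdgeSlots : List (Fin m × HB n m r)
  allEdgeSlots = cartesianProduct (allFin m) (allB n m r)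

  _≟B_ : (y z : HB n m r) → Dec (y ≡ z)
  _≟B_ = Sum.≡-dec _≟F_ (Product.≡-dec _≟F_ _≟F_)

  bᵥ : Fin n → HVertex n m r
  bᵥ v = inj₂ (inj₁ v)

  selection : List (Fin n) → List (Fin m) → List (HVertex n m r)
  selection K I = map bᵥ K ++ map inj₁ I

  selection-length : (K : List (Fin n)) (I : List (Fin m)) →
    length (selection K I) ≡ length K + length I
  selection-length K I = trans (length-++ (map bᵥ K)) (cong₂ _+_ (length-map bᵥ K) (length-map inj₁ I))

  ∈-allB : (y : HB n m r) → y ∈ allB n m r
  ∈-allB (inj₁ v)       = ∈-++⁺ˡ (∈-map⁺ inj₁ (∈-allFin v))
  ∈-allB (inj₂ (i , j)) =
    ∈-++⁺ʳ (map inj₁ (allFin n)) (∈-map⁺ inj₂ (∈-cartesianProduct⁺ (∈-allFin i) (∈-allFin j)))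

  -- a_i has degree at least r − 1 in H: its neighbours are the two endpoints of eᵢ
  -- (distinct, as G has no loops) and the r − 3 pendant vertices p_{i,j}
  a-degree : IsSimpleEdgeList e → (i : Fin m) → r ∸ 1 ≤ count (hEdge? r e i) (allB n m r)
  a-degree simple i = begin
    r ∸ 1              ≤⟨ m≤n+m∸n (r ∸ 1) 2 ⟩
    2 + (r ∸ 1 ∸ 2)    ≡⟨ cong (2 +_) (∸-+-assoc r 1 2) ⟩
    2 + (r ∸ 3)        ≡⟨ cong (2 +_) (trans (length-map pᵢ (allFin (r ∸ 3))) (length-tabulate (λ j → j))) ⟨
    length neighbours  ≤⟨ distinct-≤-count _≟B_ (hEdge? r e i) neighbours distinct adjacent ⟩
    count (hEdge? r e i) (allB n m r) ∎
    where
    open ≤-Reasoning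
    pᵢ : Fin (r ∸ 3) → HB n m r
    pᵢ j = inj₂ (i , j)
    neighbours : List (HB n m r)
    neighbours = inj₁ (proj₁ (e i)) ∷ inj₁ (proj₂ (e i)) ∷ map pᵢ (allFin (r ∸ 3))
    distinct : Unique neighbours
    distinct = ((λ eq → Fin.<⇒≢ (proj₁ simple i) (Sum.inj₁-injective eq))
                 ∷ All.map⁺ (All.universal (λ _ ()) _))
             ∷ All.map⁺ (All.universal (λ _ ()) _)
             ∷ Unique.map⁺ (λ { refl → refl }) (Unique.allFin⁺ (r ∸ 3))
    adjacent : All (λ y → y ∈ allB n m r × HEdge r e i y) neighbours
    adjacent = (∈-allB _ , inj₁ refl) ∷ (∈-allB _ , inj₂ refl)
             ∷ All.map⁺ (All.universal (λ _ → ∈-allB _ , refl) _)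

  module _ {K : List (Fin n)} {I : List (Fin m)} (uniqueK : Unique K) (uniqueI : Unique I)
           (I-avoids-K : All (λ i → ¬ Touches e K i) I) where

    selection-distinct : Unique (selection K I)
    selection-distinct = AllPairs.++⁺
      (Unique.map⁺ (λ { refl → refl }) uniqueK)
      (Unique.map⁺ Sum.inj₁-injective uniqueI)
      (All.map⁺ (All.universal (λ _ → All.map⁺ (All.universal (λ _ ()) I)) K))

    -- no two selected vertices are adjacent: the a_i chosen have no endpoint in K
    selection-independent : AllPairs (λ x y → ¬ HAdj r e x y) (selection K I)
    selection-independent = AllPairs.++⁺
      (AllPairs.map⁺ (AllPairs.map (λ _ ()) uniqueK))
      (AllPairs.map⁺ (AllPairs.map (λ _ ()) uniqueI))
      (All.map⁺ (All.tabulate (λ v∈K → All.map⁺ (All.map (not-incident v∈K) I-avoids-K))))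
      where
      not-incident : ∀ {v i} → v ∈ K → ¬ Touches e K i → ¬ Incident (e i) v
      not-incident v∈K avoids v∈eᵢ = avoids (Any.map (λ { refl → v∈eᵢ }) v∈K)

    Covered : Fin m × HB n m r → Set
    Covered (i , y) = HEdge r e i y × (inj₁ i ∈ selection K I ⊎ inj₂ y ∈ selection K I)

    covered? : (ab : Fin m × HB n m r) → Dec (Covered ab)
    covered? (i , y) = hEdge? r e i y ×-dec ((inj₁ i ∈H? selection K I) ⊎-dec (inj₂ y ∈H? selection K I))

    AtI : Fin m × HB n m r → Set
    AtI (i , y) = HEdge r e i y × i ∈ I

    atI? : (ab : Fin m × HB n m r) → Dec (AtI ab)
    atI? (i , y) = hEdge? r e i y ×-dec (i ∈A? I)

    Inβ : HB n m r → Set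
    Inβ (inj₁ v) = v ∈ K
    Inβ (inj₂ _) = ⊥

    inβ? : (y : HB n m r) → Dec (Inβ y)
    inβ? (inj₁ v) = v ∈β? K
    inβ? (inj₂ _) = no (λ ())

    AtK : Fin m × HB n m r → Set
    AtK (i , y) = HEdge r e i y × Inβ y

    atK? : (ab : Fin m × HB n m r) → Dec (AtK ab)
    atK? (i , y) = hEdge? r e i y ×-dec inβ? y

    -- the two kinds of edges are covered, and no edge is of both kinds since I avoids K
    covered-split : count atI? allEdgeSlots + count atK? allEdgeSlots ≤ coveredEdges r e (selection K I)
    covered-split = begin
      count atI? allEdgeSlots + count atK? allEdgeSlots
        ≤⟨ count-disjoint-≤ atI? atK? covered? atI⊆covered atK⊆covered disjoint allEdgeSlots ⟩
      count covered? allEdgeSlots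
        ≡⟨ count-filter _ (λ ab → hEdge? r e (proj₁ ab) (proj₂ ab)) allEdgeSlots ⟨
      coveredEdges r e (selection K I) ∎
      where
      open ≤-Reasoning
      atI⊆covered : ∀ {ab} → AtI ab → Covered ab
      atI⊆covered (h , i∈I) = h , inj₁ (∈-++⁺ʳ (map bᵥ K) (∈-map⁺ inj₁ i∈I))
      atK⊆covered : ∀ {ab} → AtK ab → Covered ab
      atK⊆covered {i , inj₁ v} (h , v∈K) = h , inj₂ (∈-++⁺ˡ (∈-map⁺ bᵥ v∈K))
      disjoint : ∀ {ab} → AtI ab → ¬ AtK ab
      disjoint {i , inj₁ v} (_ , i∈I) (v∈eᵢ , v∈K) =
        All.lookup I-avoids-K i∈I (Any.map (λ { refl → v∈eᵢ }) v∈K)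

    module _ (simple : IsSimpleEdgeList e) where

      edges-at-I : length I * (r ∸ 1) ≤ count atI? allEdgeSlots
      edges-at-I = begin
        length I * (r ∸ 1)
          ≡⟨ *-comm (length I) (r ∸ 1) ⟩
        (r ∸ 1) * length I
          ≤⟨ *-monoʳ-≤ (r ∸ 1) (distinct-≤-members I uniqueI) ⟩
        (r ∸ 1) * count (_∈A? I) (allFin m)
          ≤⟨ sum-≥ (_∈A? I) (r ∸ 1) (λ i → count (λ y → atI? (i , y)) (allB n m r)) at-aᵢ (allFin m) ⟩
        sum (map (λ i → count (λ y → atI? (i , y)) (allB n m r)) (allFin m))
          ≡⟨ count-cartesianProduct atI? (allFin m) (allB n m r) ⟨
        count atI? allEdgeSlots ∎
        where
        open ≤-Reasoning
        at-aᵢ : ∀ {i} → i ∈ I → r ∸ 1 ≤ count (λ y → atI? (i , y)) (allB n m r)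
        at-aᵢ {i} i∈I = ≤-trans (a-degree simple i) (count-mono (hEdge? r e i) _ (λ h → h , i∈I) (allB n m r))

      module _ (regular : IsRegular r e) where

        -- each b_v with v ∈ K covers the r edges a_i b_v with v ∈ eᵢ; counting these pairs
        -- (i , v) vertex by vertex instead of edge slot by edge slot needs double counting
        edges-at-K : length K * r ≤ count atK? allEdgeSlots
        edges-at-K = begin
          length K * r
            ≡⟨ *-comm (length K) r ⟩
          r * length K
            ≤⟨ *-monoʳ-≤ r (distinct-≤-members K uniqueK) ⟩
          r * count (_∈β? K) (allFin n)
            ≤⟨ sum-≥ (_∈β? K) r (λ v → count (λ i → atK? (i , inj₁ v)) (allFin m)) at-bᵥ (allFin n) ⟩
          sum (map (λ v → count (λ i → atK? (i , inj₁ v)) (allFin m)) (allFin n))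
            ≡⟨ sum-swap (λ i v → atK? (i , inj₁ v)) (allFin m) (allFin n) ⟨
          sum (map (λ i → count (λ v → atK? (i , inj₁ v)) (allFin n)) (allFin m))
            ≤⟨ sum-mono _ _ β-part (allFin m) ⟩
          sum (map (λ i → count (λ y → atK? (i , y)) (allB n m r)) (allFin m))
            ≡⟨ count-cartesianProduct atK? (allFin m) (allB n m r) ⟨
          count atK? allEdgeSlots ∎
          where
          open ≤-Reasoning
          at-bᵥ : ∀ {v} → v ∈ K → r ≤ count (λ i → atK? (i , inj₁ v)) (allFin m)
          at-bᵥ {v} v∈K = ≤-trans (≤-reflexive (sym (regular v)))
                                  (count-mono (λ i → incident? (e i) v) _ (λ h → h , v∈K) (allFin m))
          β-part : ∀ i → count (λ v → atK? (i , inj₁ v)) (allFin n) ≤ count (λ y → atK? (i , y)) (allB n m r)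
          β-part i = begin
            count (λ v → atK? (i , inj₁ v)) (allFin n)
              ≡⟨ count-map (λ y → atK? (i , y)) inj₁ (allFin n) ⟨
            count (λ y → atK? (i , y)) (map inj₁ (allFin n))
              ≤⟨ m≤m+n _ _ ⟩
            count (λ y → atK? (i , y)) (map inj₁ (allFin n)) + count (λ y → atK? (i , y)) pendants
              ≡⟨ count-++ (λ y → atK? (i , y)) (map inj₁ (allFin n)) pendants ⟨
            count (λ y → atK? (i , y)) (allB n m r) ∎
            where
            pendants : List (HB n m r)
            pendants = map inj₂ (cartesianProduct (allFin m) (allFin (r ∸ 3)))

        selection-covers : length K * r + length I * (r ∸ 1) ≤ coveredEdges r e (selection K I)
        selection-covers = begin
          length K * r + length I * (r ∸ 1)                  ≤⟨ +-mono-≤ edges-at-K edges-at-I ⟩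
          count atK? allEdgeSlots + count atI? allEdgeSlots  ≡⟨ +-comm (count atK? allEdgeSlots) _ ⟩
          count atI? allEdgeSlots + count atK? allEdgeSlots  ≤⟨ covered-split ⟩
          coveredEdges r e (selection K I) ∎
          where open ≤-Reasoning

lemma1 : (n m : ℕ) → n > 11 → (e : EdgeList n m) → IsSimpleEdgeList e →
    IsRegular (n ∸ 4) e → (k : ℕ) → k ≥ 1 → HasClique e k →
    Σ (List (HVertex n m (n ∸ 4))) (λ S →
      (length S ≡ k + (m ∸ (k * (n ∸ 4) ∸ (k C 2)))) ×
      AllPairs (λ u v → ¬ (u ≡ v)) S ×
      AllPairs (λ u v → ¬ HAdj (n ∸ 4) e u v) S ×
      (coveredEdges (n ∸ 4) e S ≥ k * (n ∸ 4) + (m ∸ (k * (n ∸ 4) ∸ (k C 2))) * (n ∸ 4 ∸ 1)))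
lemma1 n m _ e simple regular k _ (K , |K|≡k , clique) =
  selection e r K I , size , selection-distinct e r uniqueK uniqueI I-avoids-K
  , selection-independent e r uniqueK uniqueI I-avoids-K , covers
  where
  r x : ℕ
  r = n ∸ 4
  x = m ∸ (k * r ∸ k C 2)
  uniqueK : Unique K
  uniqueK = AllPairs.map (adjacent⇒distinct e simple) clique
  avoiding : List (Fin m)
  avoiding = filter (avoids? e K) (allFin m)
  I : List (Fin m)
  I = take x avoiding
  |I|≡x : length I ≡ x
  |I|≡x = trans (length-take x avoiding) (m≤n⇒m⊓n≡m
    (subst (λ l → m ∸ (l * r ∸ l C 2) ≤ length avoiding) |K|≡k
           (many-edges-avoid-clique e simple regular K clique)))
  uniqueI : Unique I
  uniqueI = Unique.take⁺ x (Unique.filter⁺ (avoids? e K) (Unique.allFin⁺ m))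
  I-avoids-K : All (λ i → ¬ Touches e K i) I
  I-avoids-K = All.take⁺ x (All.all-filter (avoids? e K) (allFin m))
  size : length (selection e r K I) ≡ k + x
  size = trans (selection-length e r K I) (cong₂ _+_ |K|≡k |I|≡x)
  covers : k * r + x * (r ∸ 1) ≤ coveredEdges r e (selection e r K I)
  covers = subst (λ (l , i) → l * r + i * (r ∸ 1) ≤ coveredEdges r e (selection e r K I))
                 (cong₂ _,_ |K|≡k |I|≡x) (selection-covers e r uniqueK uniqueI I-avoids-K simple regular)
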